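{- Let $\leadsto$ be a Noetherian relation on a type $A$. Then the relation $\leadsto^{+\circ+}$ on the type of cycles of $\leadsto$ is Noetherian.
   Context: Homotopy type theory setting; relations are arbitrary type families $A\to A\to\mathcal U$. Accessibility: $\mathsf{acc}^<$ is inductively generated by $\mathsf{step}:(\Pi x.(x<a)\to\mathsf{acc}^<(x))\to\mathsf{acc}^<(a)$; $<$ is well-founded if every element is accessible; a relation is Noetherian if its opposite is well-founded. Closures: $\leadsto^+$ is the transitive closure (inductive with constructors $(a\leadsto b)\to(a\leadsto^+b)$ and $(a\leadsto^+b)\to(b\leadsto c)\to(a\leadsto^+c)$); $\leadsto^*$ reflexive-transitive closure; $(a\leadsto^sb):=(a\leadsto b)+(b\leadsto a)$; $\leadsto^{s*}:=(\leadsto^s)^*$. A cycle is an element of $\Sigma(a:A).(a\leadsto^{s*}a)$. The vertex list $\pi(\gamma)\in\mathsf{List}\,A$ of a chain is defined by $\pi(\mathsf{nil})=\mathsf{nil}$ and $\pi(\mathsf{snoc}(\alpha,p))=\pi(\alpha)::c$ where $c$ is the endpoint of segment $p$ (so the initial vertex is omitted). $\mathsf{rot}$ on lists moves the first element (if any) to the end; on cycles it moves the first segment to the end, commuting with $\pi$. For a relation $R$ on $A$ and lists $k,l$, write $k\triangleright_R l$ if $l$ is obtained from $k$ by replacing a single element $x$ of $k$ by a finite list of elements $y$ each satisfying $x\mathrel{R}y$. For cycles $\gamma,\delta$, set $\gamma\mathrel{R^{\circ}}\delta$ iff there is $n:\mathbb N$ with $\pi(\gamma)\triangleright_R\mathsf{rot}^n(\pi(\delta))$.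 Then $\leadsto^{+\circ+}$ is the transitive closure of $(\leadsto^+)^{\circ}$. (This is the list/multiset-style extension oriented along $\leadsto$, so that $\delta$ is "smaller" than $\gamma$.) -}

{-# OPTIONS --without-K #-}
module Defs where

open import Level using (Level; _⊔_)
open import Data.Nat using (ℕ; zero; suc)
open import Data.List using (List; []; _∷_; _++_; _∷ʳ_)
open import Data.List.Relation.Unary.All using (All)
open import Data.Product using (Σ; ∃; _×_; _,_)
open import Data.Sum using (_⊎_)
open import Relation.Binary.PropositionalEquality using (_≡_)
open import Relation.Binary.Core using (Rel)
open import Function using (flip)
open import Induction.WellFounded using (WellFounded)

Noetherian : ∀ {a ℓ} {A : Set a} → Rel A ℓ → Set (a ⊔ ℓ)
Noetherian R = WellFounded (flip R)

module _ {a ℓ : Level} {A : Set a} where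

  data TransClo (R : Rel A ℓ) : Rel A (a ⊔ ℓ) where
    [_] : ∀ {x y} → R x y → TransClo R x y
    _▹_ : ∀ {x y z} → TransClo R x y → R y z → TransClo R x z

  data Chain (R : Rel A ℓ) : Rel A (a ⊔ ℓ) where
    nil  : ∀ {x} → Chain R x x
    snoc : ∀ {x y z} → Chain R x y → R y z → Chain R x z

  SymClo : Rel A ℓ → Rel A ℓ
  SymClo R x y = R x y ⊎ R y x

  -- vertex list of a chain (initial vertex omitted)
  π : ∀ {R : Rel A ℓ} {x y} → Chain R x y → List A
  π nil = []
  π (snoc {z = c} α p) = π α ∷ʳ c

Cycle : ∀ {a ℓ} {A : Set a} → Rel A ℓ → Set (a ⊔ ℓ)
Cycle {A = A} R = Σ A (λ x → Chain (SymClo R) x x)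

πᶜ : ∀ {a ℓ} {A : Set a} {R : Rel A ℓ} → Cycle R → List A
πᶜ (_ , γ) = π γ

rot : ∀ {a} {A : Set a} → List A → List A
rot []       = []
rot (x ∷ xs) = xs ∷ʳ x

rot^ : ∀ {a} {A : Set a} → ℕ → List A → List A
rot^ zero    l = l
rot^ (suc n) l = rot (rot^ n l)

_▷⟨_⟩_ : ∀ {a ℓ} {A : Set a} → List A → Rel A ℓ → List A → Set (a ⊔ ℓ)
_▷⟨_⟩_ {A = A} k R l =
  Σ (List A) λ k₁ → Σ A λ x → Σ (List A) λ k₂ → Σ (List A) λ ys →
    (k ≡ k₁ ++ (x ∷ k₂)) × (l ≡ k₁ ++ (ys ++ k₂)) × All (R x) ys

CycExt : ∀ {a ℓ ℓ'} {A : Set a} (⇝ : Rel A ℓ) → Rel A ℓ' → Rel (Cycle ⇝) (a ⊔ ℓ')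
CycExt ⇝ R γ δ = Σ ℕ λ n → πᶜ γ ▷⟨ R ⟩ rot^ n (πᶜ δ)

CycOrder : ∀ {a ℓ} {A : Set a} (⇝ : Rel A ℓ) → Rel (Cycle ⇝) (a ⊔ ℓ)
CycOrder ⇝ = TransClo (CycExt ⇝ (TransClo ⇝))

module Submission where

-- A cycle is compared with another one only through its vertex
-- list, and a step  γ (⇝⁺)° δ  replaces one vertex x of π(γ) by finitely many
-- ⇝⁺-successors of x and then rotates.  Forgetting the order of the list (a
-- rotation is a permutation) turns this into one step of the multiset
-- extension of ⇝⁺.

open import Defs
open import Level using (Level; _⊔_)
open import Relation.Binary.Core using (Rel; _⇒_)
open import Relation.Binary.Construct.On as On using ()
open import Relation.Binary.Construct.Closure.Transitive as Plus
  using (TransClosure; [_]; _∷_)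
open import Data.Nat using (zero; suc)
open import Data.List using (List; []; _∷_; _++_)
open import Data.List.Relation.Unary.All using (All; []; _∷_)
open import Data.List.Relation.Unary.Any using (here; there)
open import Data.List.Membership.Propositional.Properties using (∈-∃++)
open import Data.List.Relation.Binary.Permutation.Propositional
  using (_↭_; refl; prep; swap; ↭-sym; ↭-trans)
open import Data.List.Relation.Binary.Permutation.Propositional.Properties
  using (∈-resp-↭; shift; shifts; drop-∷; ¬x∷xs↭[]; ++⁺ˡ; ∷↭∷ʳ)
open import Data.Product using (Σ; _×_; _,_)
open import Data.Sum using (_⊎_; inj₁; inj₂)
open import Relation.Nullary using (contradiction)
open import Relation.Binary.PropositionalEquality using (_≡_; refl)
open import Function using (flip)
open import Induction.WellFounded
  using (Acc; acc; Acc-resp-flip-≈; module Subrelation)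

private
  variable
    a ℓ ℓ′ : Level
    A : Set a

-- A ⇝-chain read backwards is a chain of the opposite relation; the
-- transitive closure of  flip R  is well-founded by the standard library.
TransClo⇒opposite : {R : Rel A ℓ} → flip (TransClo R) ⇒ TransClosure (flip R)
TransClo⇒opposite [ p ]   = [ p ]
TransClo⇒opposite (t ▹ p) = p ∷ TransClo⇒opposite t

transClo-noetherian : (R : Rel A ℓ) → Noetherian R → Noetherian (TransClo R)
transClo-noetherian R wf =
  Subrelation.wellFounded TransClo⇒opposite (Plus.wellFounded (flip R) wf)

MultisetStep : {A : Set a} → Rel A ℓ → Rel (List A) (a ⊔ ℓ)
MultisetStep {A = A} R k l = Σ A λ x → Σ (List A) λ ys → Σ (List A) λ rest →
  (k ↭ x ∷ rest) × (l ↭ ys ++ rest) × All (R x) ys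

module Multiset {a ℓ : Level} {A : Set a} (R : Rel A ℓ) where

  AccM : List A → Set (a ⊔ ℓ)
  AccM = Acc (flip (MultisetStep R))

  -- a multiset step only sees lists up to permutation, hence so does AccM
  AccM-resp-↭ : ∀ {k l} → k ↭ l → AccM k → AccM l
  AccM-resp-↭ = Acc-resp-flip-≈ λ l↭k (x , ys , rest , k↭ , m↭ , r) →
    x , ys , rest , ↭-trans l↭k k↭ , m↭ , r

  remove-from-cons : ∀ {x z : A} {M rest} → x ∷ M ↭ z ∷ rest →
    (z ≡ x × M ↭ rest) ⊎
    (Σ (List A) λ rest' → (M ↭ z ∷ rest') × (rest ↭ x ∷ rest'))
  remove-from-cons {x} {z} p with ∈-resp-↭ (↭-sym p) (here refl)
  ... | here refl  = inj₁ (refl , drop-∷ p)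
  ... | there z∈M with ∈-∃++ z∈M
  ...   | as , bs , refl = inj₂ (as ++ bs , shift z as bs ,
          drop-∷ (↭-trans (↭-sym p)
                   (↭-trans (prep x (shift z as bs)) (swap x z refl))))

  -- Adding an accessible element to an accessible multiset.  Outer induction
  -- on x (its R-successors may be added freely), inner induction on M.
  acc-cons : ∀ {x} → Acc (flip R) x → ∀ {M} → AccM M → AccM (x ∷ M)
  acc-cons {x} (acc below-x) = insert
    where
    acc-++ : ∀ ys {N} → All (R x) ys → AccM N → AccM (ys ++ N)
    acc-++ []       []         accN = accN
    acc-++ (y ∷ ys) (xRy ∷ rs) accN = acc-cons (below-x xRy) (acc-++ ys rs accN)

    insert : ∀ {M} → AccM M → AccM (x ∷ M)
    insert {M} (acc below-M) = acc λ (z , ys , rest , p , L↭ , rs) →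
      AccM-resp-↭ (↭-sym L↭) (after-step p rs)
      where
      after-step : ∀ {z ys rest} → x ∷ M ↭ z ∷ rest → All (R z) ys →
        AccM (ys ++ rest)
      after-step {ys = ys} p rs with remove-from-cons p
      ... | inj₁ (refl , M↭rest) =
            acc-++ ys rs (AccM-resp-↭ M↭rest (acc below-M))
      ... | inj₂ (rest' , M↭ , rest↭) =
            AccM-resp-↭ (↭-sym (↭-trans (++⁺ˡ ys rest↭) (shift x ys rest')))
              (insert (below-M (_ , ys , rest' , M↭ , refl , rs)))

  multiset-noetherian : Noetherian R → Noetherian (MultisetStep R)
  multiset-noetherian wf []      = acc λ (_ , _ , _ , p , _) →
    contradiction (↭-sym p) ¬x∷xs↭[]
  multiset-noetherian wf (x ∷ l) = acc-cons (wf x) (multiset-noetherian wf l)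

rot^-↭ : ∀ n (l : List A) → rot^ n l ↭ l
rot^-↭ zero    l = refl
rot^-↭ (suc n) l = ↭-trans (rot-↭ (rot^ n l)) (rot^-↭ n l)
  where
  rot-↭ : ∀ (l : List A) → rot l ↭ l
  rot-↭ []       = refl
  rot-↭ (x ∷ xs) = ↭-sym (∷↭∷ʳ x xs)

▷⇒MultisetStep : {R : Rel A ℓ} {k l : List A} →
  k ▷⟨ R ⟩ l → MultisetStep R k l
▷⇒MultisetStep (k₁ , x , k₂ , ys , refl , refl , rs) =
  x , ys , k₁ ++ k₂ , shift x k₁ k₂ , shifts k₁ ys , rs

CycExt⇒MultisetStep : (⇝ : Rel A ℓ) (R : Rel A ℓ′) {γ δ : Cycle ⇝} →
  CycExt ⇝ R γ δ → MultisetStep R (πᶜ γ) (πᶜ δ)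
CycExt⇒MultisetStep ⇝ R {δ = δ} (n , step) with ▷⇒MultisetStep step
... | x , ys , rest , k↭ , l↭ , rs =
  x , ys , rest , k↭ , ↭-trans (↭-sym (rot^-↭ n (πᶜ δ))) l↭ , rs

cycExt-noetherian : (⇝ : Rel A ℓ) (R : Rel A ℓ′) →
  Noetherian R → Noetherian (CycExt ⇝ R)
cycExt-noetherian ⇝ R wf =
  Subrelation.wellFounded (λ {δ} {γ} → CycExt⇒MultisetStep ⇝ R {γ} {δ})
    (On.wellFounded πᶜ (Multiset.multiset-noetherian R wf))

theorem5p12 : ∀ {a ℓ} {A : Set a} (_⇝_ : Rel A ℓ) →
    Noetherian _⇝_ → Noetherian (CycOrder _⇝_)
theorem5p12 _⇝_ wf = transClo-noetherian (CycExt _⇝_ (TransClo _⇝_)) ext-wf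
  where
  ext-wf : Noetherian (CycExt _⇝_ (TransClo _⇝_))
  ext-wf = cycExt-noetherian _⇝_ (TransClo _⇝_)
             (transClo-noetherian _⇝_ wf)
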